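{- For every odd integer $n\ge 5$, $$\left\lceil\frac{n+15}{4}\right\rceil\le g^4(C_n)\le \left\lfloor\frac{n+6}{2}\right\rfloor.$$
   Context: $C_n$ denotes the cyclic group of order $n$. For a finite abelian group $G$ (written additively) and a positive integer $k$, the $k$-Harborth constant $g^k(G)$ is the smallest positive integer $t$ such that every subset $S\subseteq G$ with $|S|\ge t$ contains a subset $T$ with $|T|=k$ and $\sum_{x\in T}x=0$. -}

module Defs where

open import Data.Nat using (ℕ; zero; suc; _+_; _≤_)
open import Data.Nat.Divisibility using () renaming (_∣_ to _divides_)
open import Data.Bool using (if_then_else_)
open import Data.Fin using (Fin; toℕ)
open import Data.Fin.Subset using (Subset; _⊆_; ∣_∣)
open import Data.Vec using (lookup; tabulate; sum)
open import Data.Product using (Σ; _×_)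
open import Relation.Binary.PropositionalEquality using (_≡_)

-- The cyclic group C_n is modelled as Fin n = {0,…,n-1} with addition mod n.
-- The group-sum of the elements of T ⊆ C_n is the residue mod n of the sum
-- of their representatives; it is 0 in C_n iff that natural sum is divisible by n.
subsetSum : {n : ℕ} → Subset n → ℕ
subsetSum {n} T = sum (tabulate (λ (i : Fin n) → if lookup T i then toℕ i else 0))

HasZeroSumSubset : (n : ℕ) (k : ℕ) → Subset n → Set
HasZeroSumSubset n k S = Σ (Subset n) λ T → T ⊆ S × ∣ T ∣ ≡ k × n divides subsetSum T

HarborthProperty : (n : ℕ) (k t : ℕ) → Set
HarborthProperty n k t = (S : Subset n) → t ≤ ∣ S ∣ → HasZeroSumSubset n k S

IsHarborthConstant : (n : ℕ) (k g : ℕ) → Set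
IsHarborthConstant n k g =
  1 ≤ g × HarborthProperty n k g × ((t : ℕ) → 1 ≤ t → HarborthProperty n k t → g ≤ t)

{-# OPTIONS --safe #-}
module Submission where

-- Write n = 2m + 1.  The nonzero residues of C_n fall into the m pairs {x, n − x}.
-- A set of m + 3 residues has at least m + 2 nonzero elements, so by pigeonhole it
-- contains two whole pairs, and these four elements sum to 2n ≡ 0: hence
-- g⁴(C_n) ≤ m + 3.  Conversely, the set {0, 1, …, s − 1, n − 1} of size s + 1 has no
-- zero-sum 4-subset when 4s ≤ n + 9 and 3s < n + 7: a 4-subset avoiding n − 1 has
-- its sum strictly between 0 and n, one containing n − 1 strictly between n and 2n.
-- The largest such s is ⌊(n + 18)/4⌋ − 2, whence g⁴(C_n) ≥ s + 2.  The constant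
-- itself exists as the least t with the (decidable) Harborth property.

open import Data.Bool using (Bool; true; false; if_then_else_; _∨_)
open import Data.Empty using (⊥)
open import Data.Fin as Fin using (toℕ)
open import Data.Fin.Properties using (toℕ-fromℕ<)
open import Data.Fin.Subset using (Subset; ∣_∣; _∈_; _⊆_)
open import Data.Fin.Subset.Properties using (anySubset?; _⊆?_)
open import Data.List using (List; []; _∷_; map; length; upTo)
open import Data.List.Membership.Propositional using () renaming (_∈_ to _∈ₗ_)
open import Data.List.Membership.Propositional.Properties using (∈-upTo⁻)
open import Data.List.Properties using (map-id; length-upTo)
open import Data.List.Relation.Unary.All as All using (All; []; _∷_)
open import Data.List.Relation.Unary.All.Properties using (All¬⇒¬Any; all-upTo)
open import Data.List.Relation.Unary.AllPairs as AllPairs using ([]; _∷_)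
open import Data.List.Relation.Unary.Any using (here; there)
open import Data.List.Relation.Unary.Linked using ([-]; _∷_)
open import Data.List.Relation.Unary.Linked.Properties using (Linked⇒AllPairs)
open import Data.List.Relation.Unary.Unique.Propositional using (Unique)
open import Data.List.Relation.Unary.Unique.Propositional.Properties using (upTo⁺)
open import Data.Nat
open import Data.Nat.DivMod using (+-distrib-/-∣ˡ; m*n/n≡m; m<n⇒m/n≡0)
open import Data.Nat.Divisibility using (_∣_; _∣?_; divides)
open import Data.Nat.Induction using (<-rec)
open import Data.Nat.ListAction using (sum)
open import Data.Nat.Properties
open import Algebra.Properties.CommutativeSemigroup +-commutativeSemigroup using (x∙yz≈y∙xz)
open import Data.List.Membership.DecPropositional _≟_ using (_∈?_)
open import Data.Nat.Tactic.RingSolver using (solve-∀)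
open import Data.Product using (Σ; _×_; _,_)
open import Data.Sum using (_⊎_; inj₁; inj₂)
open import Data.Vec using ([]; _∷_; lookup; tabulate)
import Data.Vec as Vec
open import Data.Vec.Properties using (lookup∘tabulate; []=⇒lookup; lookup⇒[]=)
open import Function using (_∘_)
open import Relation.Binary.PropositionalEquality
open import Relation.Nullary using (Dec; yes; no; does; ¬_; ¬?; contradiction)
open import Relation.Nullary.Decidable using (dec-true; dec-false; decidable-stable; _×-dec_; _→-dec_)
open import Relation.Unary as U using (Pred)

open import Defs

does-true⇒ : ∀ {a} {A : Set a} (a? : Dec A) → does a? ≡ true → A
does-true⇒ (yes a) _ = a

sumWhere : (ℕ → ℕ) → (ℕ → Bool) → ℕ → ℕ → ℕ
sumWhere w p o zero    = 0
sumWhere w p o (suc l) = (if p o then w o else 0) + sumWhere w p (suc o) l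

count total : (ℕ → Bool) → ℕ → ℕ → ℕ
count = sumWhere (λ _ → 1)
total = sumWhere (λ x → x)

module _ (w : ℕ → ℕ) where

  sumWhere-shift : ∀ p o l → sumWhere w p (suc o) l ≡ sumWhere (w ∘ suc) (p ∘ suc) o l
  sumWhere-shift p o zero    = refl
  sumWhere-shift p o (suc l) = cong (_ +_) (sumWhere-shift p (suc o) l)

  sumWhere-snoc : ∀ p o l →
    sumWhere w p o (suc l) ≡ sumWhere w p o l + (if p (o + l) then w (o + l) else 0)
  sumWhere-snoc p o zero    rewrite +-identityʳ o = +-comm _ 0
  sumWhere-snoc p o (suc l) rewrite sumWhere-snoc p (suc o) l | +-suc o l =
    sym (+-assoc (if p o then w o else 0) _ _)

  sumWhere-false : ∀ p o l → (∀ x → o ≤ x → p x ≡ false) → sumWhere w p o l ≡ 0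
  sumWhere-false p o zero    _  = refl
  sumWhere-false p o (suc l) p≡false rewrite p≡false o ≤-refl =
    sumWhere-false p (suc o) l (λ x o<x → p≡false x (<⇒≤ o<x))

  sumWhere-∨ : ∀ p q o l → (∀ x → p x ≡ true → q x ≡ false) →
    sumWhere w (λ x → p x ∨ q x) o l ≡ sumWhere w p o l + sumWhere w q o l
  sumWhere-∨ p q o zero    _        = refl
  sumWhere-∨ p q o (suc l) disjoint with p o in po
  ... | true  rewrite disjoint o po =
    trans (cong (w o +_) (sumWhere-∨ p q (suc o) l disjoint)) (sym (+-assoc (w o) _ _))
  ... | false =
    trans (cong (_ +_) (sumWhere-∨ p q (suc o) l disjoint))
      (x∙yz≈y∙xz (if q o then w o else 0) (sumWhere w p (suc o) l) _)

  sumWhere-point : ∀ a o l → o ≤ a → a < o + l → sumWhere w (λ x → does (x ≟ a)) o l ≡ w a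
  sumWhere-point a o zero    o≤a a<o = contradiction (subst (a <_) (+-identityʳ o) a<o) (≤⇒≯ o≤a)
  sumWhere-point a o (suc l) o≤a a<o+l with o ≟ a
  ... | yes refl rewrite dec-true (o ≟ o) refl =
    trans (cong (w o +_) (sumWhere-false _ (suc o) l after)) (+-identityʳ (w o))
    where
    after : ∀ x → suc o ≤ x → does (x ≟ o) ≡ false
    after x o<x = dec-false (x ≟ o) λ { refl → n≮n o o<x }
  ... | no  o≢a  rewrite dec-false (o ≟ a) o≢a =
    sumWhere-point a (suc o) l (≤∧≢⇒< o≤a o≢a) (subst (a <_) (+-suc o l) a<o+l)

  sumWhere-∈ : ∀ xs o l → Unique xs → All (λ x → o ≤ x × x < o + l) xs →
    sumWhere w (λ x → does (x ∈? xs)) o l ≡ sum (map w xs)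
  sumWhere-∈ []       o l _              _ = sumWhere-false _ o l (λ _ _ → refl)
  sumWhere-∈ (a ∷ as) o l (a∉as ∷ uniq) ((o≤a , a<o+l) ∷ inRange) = begin
    sumWhere w (λ x → does (x ≟ a) ∨ does (x ∈? as)) o l
      ≡⟨ sumWhere-∨ _ _ o l disjoint ⟩
    sumWhere w (λ x → does (x ≟ a)) o l + sumWhere w (λ x → does (x ∈? as)) o l
      ≡⟨ cong₂ _+_ (sumWhere-point a o l o≤a a<o+l) (sumWhere-∈ as o l uniq inRange) ⟩
    w a + sum (map w as) ∎
    where
    open ≡-Reasoning
    disjoint : ∀ x → does (x ≟ a) ≡ true → does (x ∈? as) ≡ false
    disjoint x x≟a with refl ← does-true⇒ (x ≟ a) x≟a = dec-false (x ∈? as) (All¬⇒¬Any a∉as)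

count-∈ : ∀ xs o l → Unique xs → All (λ x → o ≤ x × x < o + l) xs →
  count (λ x → does (x ∈? xs)) o l ≡ length xs
count-∈ xs o l uniq inRange = trans (sumWhere-∈ (λ _ → 1) xs o l uniq inRange) (sum-map-1 xs)
  where
  sum-map-1 : ∀ (ys : List ℕ) → sum (map (λ _ → 1) ys) ≡ length ys
  sum-map-1 []       = refl
  sum-map-1 (_ ∷ ys) = cong suc (sum-map-1 ys)

triangular : ℕ → ℕ
triangular zero    = 0
triangular (suc c) = c + triangular c

MarkedBelow : (ℕ → Bool) → ℕ → ℕ → Set
MarkedBelow p hi e = ∀ x → x < e → p x ≡ true → x < hi

module _ (p : ℕ → Bool) where

  total-≥ : ∀ o l → count p o l * o + triangular (count p o l) ≤ total p o l
  total-≥ o zero    = z≤n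
  total-≥ o (suc l) with p o | total-≥ (suc o) l
  ... | false | ih = ≤-trans (+-monoˡ-≤ _ (*-monoʳ-≤ (count p (suc o) l) (n≤1+n o))) ih
  ... | true  | ih = begin
    suc c * o + (c + triangular c)   ≡⟨ regroup o c (triangular c) ⟩
    o + (c * suc o + triangular c)   ≤⟨ +-monoʳ-≤ o ih ⟩
    o + total p (suc o) l            ∎
    where
    open ≤-Reasoning
    c = count p (suc o) l
    regroup : ∀ o c t → suc c * o + (c + t) ≡ o + (c * suc o + t)
    regroup = solve-∀

  module _ (hi : ℕ) where

    private
      shrink : ∀ {o l} → MarkedBelow p hi (o + suc l) → MarkedBelow p hi (suc o + l)
      shrink {o} {l} = subst (MarkedBelow p hi) (+-suc o l)

    count-≤ : ∀ o l → MarkedBelow p hi (o + l) → count p o l ≤ hi ∸ o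
    count-≤ o zero    _     = z≤n
    count-≤ o (suc l) below with p o in p-o
    ... | false = ≤-trans (count-≤ (suc o) l (shrink below)) (∸-monoʳ-≤ hi (n≤1+n o))
    ... | true  = m+n≤o⇒m≤o∸n (suc c) (subst (_≤ hi) (+-suc c o) (m≤o∸n⇒m+n≤o c o<hi ih))
      where
      c = count p (suc o) l
      ih = count-≤ (suc o) l (shrink below)
      o<hi = below o (m<m+n o z<s) p-o

    total-≤ : ∀ o l → MarkedBelow p hi (o + l) →
      total p o l + triangular (count p o l) + count p o l ≤ count p o l * hi
    total-≤ o zero    _     = z≤n
    total-≤ o (suc l) below with p o in p-o
    ... | false = total-≤ (suc o) l (shrink below)
    ... | true  = begin
      o + t + (c + triangular c) + suc c     ≡⟨ regroup o t c (triangular c) ⟩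
      (t + triangular c + c) + (c + suc o)   ≤⟨ +-mono-≤ (total-≤ (suc o) l (shrink below)) c+1+o≤hi ⟩
      c * hi + hi                            ≡⟨ +-comm (c * hi) hi ⟩
      suc c * hi                             ∎
      where
      open ≤-Reasoning
      c = count p (suc o) l
      t = total p (suc o) l
      c+1+o≤hi : c + suc o ≤ hi
      c+1+o≤hi = m≤o∸n⇒m+n≤o c (below o (m<m+n o z<s) p-o) (count-≤ (suc o) l (shrink below))
      regroup : ∀ o t c u → o + t + (c + u) + suc c ≡ (t + u + c) + (c + suc o)
      regroup = solve-∀

-- Subsets of C_n as markings of [0, n)

member : ∀ {n} → Subset n → ℕ → Bool
member []      _       = false
member (b ∷ v) zero    = b
member (b ∷ v) (suc x) = member v x

member-toℕ : ∀ {n} (v : Subset n) i → member v (toℕ i) ≡ lookup v i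
member-toℕ (b ∷ v) Fin.zero    = refl
member-toℕ (b ∷ v) (Fin.suc i) = member-toℕ v i

member⇒< : ∀ {n} (v : Subset n) x → member v x ≡ true → x < n
member⇒< (b ∷ v) zero    _ = z<s
member⇒< (b ∷ v) (suc x) e = s<s (member⇒< v x e)

card≡count : ∀ {n} (v : Subset n) p → (∀ i → p (toℕ i) ≡ lookup v i) → ∣ v ∣ ≡ count p 0 n
card≡count []              p _     = refl
card≡count {suc n} (b ∷ v) p agree =
  trans (head b) (cong (λ c → (if c then 1 else 0) + count p 1 n) (sym (agree Fin.zero)))
  where
  tail : ∣ v ∣ ≡ count p 1 n
  tail = trans (card≡count v (p ∘ suc) (agree ∘ Fin.suc)) (sym (sumWhere-shift (λ _ → 1) p 0 n))
  head : ∀ b → ∣ b ∷ v ∣ ≡ (if b then 1 else 0) + count p 1 n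
  head true  = cong suc tail
  head false = tail

sum-tabulate≡sumWhere : ∀ {n} (w : ℕ → ℕ) (v : Subset n) p → (∀ i → p (toℕ i) ≡ lookup v i) →
  Vec.sum (tabulate (λ i → if lookup v i then w (toℕ i) else 0)) ≡ sumWhere w p 0 n
sum-tabulate≡sumWhere w []              p _     = refl
sum-tabulate≡sumWhere {suc n} w (b ∷ v) p agree =
  cong₂ (λ c t → (if c then w 0 else 0) + t) (sym (agree Fin.zero)) (begin
    Vec.sum (tabulate (λ i → if lookup v i then w (suc (toℕ i)) else 0))
      ≡⟨ sum-tabulate≡sumWhere (w ∘ suc) v (p ∘ suc) (agree ∘ Fin.suc) ⟩
    sumWhere (w ∘ suc) (p ∘ suc) 0 n
      ≡⟨ sumWhere-shift w p 0 n ⟨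
    sumWhere w p 1 n ∎)
  where open ≡-Reasoning

subsetSum≡total : ∀ {n} (v : Subset n) p → (∀ i → p (toℕ i) ≡ lookup v i) →
  subsetSum v ≡ total p 0 n
subsetSum≡total = sum-tabulate≡sumWhere (λ x → x)

fromList : ∀ n → List ℕ → Subset n
fromList n xs = tabulate (λ i → does (toℕ i ∈? xs))

module _ {n : ℕ} (xs : List ℕ) where

  private
    listed : ℕ → Bool
    listed x = does (x ∈? xs)

    agree : ∀ i → listed (toℕ i) ≡ lookup (fromList n xs) i
    agree i = sym (lookup∘tabulate (listed ∘ toℕ) i)

    inRange : All (_< n) xs → All (λ x → 0 ≤ x × x < 0 + n) xs
    inRange = All.map (z≤n ,_)

  card-fromList : Unique xs → All (_< n) xs → ∣ fromList n xs ∣ ≡ length xs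
  card-fromList uniq xs<n =
    trans (card≡count (fromList n xs) listed agree) (count-∈ xs 0 n uniq (inRange xs<n))

  subsetSum-fromList : Unique xs → All (_< n) xs → subsetSum (fromList n xs) ≡ sum xs
  subsetSum-fromList uniq xs<n =
    trans (subsetSum≡total (fromList n xs) listed agree)
      (trans (sumWhere-∈ (λ x → x) xs 0 n uniq (inRange xs<n)) (cong sum (map-id xs)))

  fromList-⊆ : (S : Subset n) → All (λ x → member S x ≡ true) xs → fromList n xs ⊆ S
  fromList-⊆ S xs⊆S {i} i∈xs = lookup⇒[]= i S (begin
    lookup S i         ≡⟨ member-toℕ S i ⟨
    member S (toℕ i)   ≡⟨ All.lookup xs⊆S i∈ₗxs ⟩
    true               ∎)
    where
    open ≡-Reasoning
    i∈ₗxs = does-true⇒ (toℕ i ∈? xs) (trans (agree i) ([]=⇒lookup i∈xs))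

  ⊆-fromList : (T : Subset n) → T ⊆ fromList n xs → ∀ x → member T x ≡ true → x ∈ₗ xs
  ⊆-fromList T T⊆xs x x∈T = does-true⇒ (x ∈? xs)
    (subst (λ y → listed y ≡ true) (toℕ-fromℕ< x<n) (trans (agree i) ([]=⇒lookup (T⊆xs i∈T))))
    where
    open ≡-Reasoning
    x<n = member⇒< T x x∈T
    i = Fin.fromℕ< x<n
    i∈T : i ∈ T
    i∈T = lookup⇒[]= i T (begin
      lookup T i         ≡⟨ member-toℕ T i ⟨
      member T (toℕ i)   ≡⟨ cong (member T) (toℕ-fromℕ< x<n) ⟩
      member T x         ≡⟨ x∈T ⟩
      true               ∎)

-- Symmetric pairs of marked points

count-peel : ∀ p o k → count p o (2 * suc k) ≡
  (if p o then 1 else 0) + (count p (suc o) (2 * k) + (if p (suc o + 2 * k) then 1 else 0))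
count-peel p o k = trans (cong (count p o) (*-suc 2 k))
  (cong ((if p o then 1 else 0) +_) (sumWhere-snoc (λ _ → 1) p (suc o) (2 * k)))

record SymmetricPair (p : ℕ → Bool) (o k : ℕ) : Set where
  field
    lo hi   : ℕ
    o≤lo    : o ≤ lo
    lo<hi   : lo < hi
    hi<end  : hi < o + 2 * k
    lo+hi   : suc (lo + hi) ≡ o + (o + 2 * k)
    p-lo    : p lo ≡ true
    p-hi    : p hi ≡ true

record NestedPairs (p : ℕ → Bool) (o k : ℕ) : Set where
  field
    outer inner : SymmetricPair p o k
    outer<inner : SymmetricPair.lo outer < SymmetricPair.lo inner
    inner<outer : SymmetricPair.hi inner < SymmetricPair.hi outer

module _ {p : ℕ → Bool} where

  private
    end-peel : ∀ o k → suc (suc o + 2 * k) ≡ o + 2 * suc k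
    end-peel = solve-∀

    unmarked-start : ∀ {j c} → suc j ≤ suc (c + 0) → j ≤ c
    unmarked-start {c = c} h = subst (_ ≤_) (+-identityʳ c) (≤-pred h)

    unmarked-end : ∀ {j c} → suc j ≤ c + 1 → j ≤ c
    unmarked-end {j} {c} h = ≤-pred (subst (suc j ≤_) (+-comm c 1) h)

    unmarked-ends : ∀ {j c} → suc j ≤ c + 0 → j ≤ c
    unmarked-ends {c = c} h = ≤-trans (n≤1+n _) (subst (_ ≤_) (+-identityʳ c) h)

  outermost : ∀ {o k} → p o ≡ true → p (suc o + 2 * k) ≡ true → SymmetricPair p o (suc k)
  outermost {o} {k} p-o p-end = record
    { lo = o ; hi = suc o + 2 * k ; o≤lo = ≤-refl ; lo<hi = s≤s (m≤m+n o (2 * k))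
    ; hi<end = ≤-reflexive (end-peel o k)
    ; lo+hi = trans (sym (+-suc o _)) (cong (o +_) (end-peel o k))
    ; p-lo = p-o ; p-hi = p-end }

  widen : ∀ {o k} → SymmetricPair p (suc o) k → SymmetricPair p o (suc k)
  widen {o} {k} π = record
    { lo = lo ; hi = hi ; o≤lo = ≤-trans (n≤1+n o) o≤lo ; lo<hi = lo<hi
    ; hi<end = <-trans hi<end (≤-reflexive (end-peel o k))
    ; lo+hi = trans lo+hi (ends o k) ; p-lo = p-lo ; p-hi = p-hi }
    where
    open SymmetricPair π
    ends : ∀ o k → suc o + (suc o + 2 * k) ≡ o + (o + 2 * suc k)
    ends = solve-∀

  symmetricPair-of-count : ∀ k o → suc k ≤ count p o (2 * k) → SymmetricPair p o k
  symmetricPair-of-count zero    o ()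
  symmetricPair-of-count (suc k) o h rewrite count-peel p o k with p o in p-o | p (suc o + 2 * k) in p-end
  ... | true  | true  = outermost p-o p-end
  ... | true  | false = widen (symmetricPair-of-count k (suc o) (unmarked-start h))
  ... | false | true  = widen (symmetricPair-of-count k (suc o) (unmarked-end h))
  ... | false | false = widen (symmetricPair-of-count k (suc o) (unmarked-ends h))

  widen-nested : ∀ {o k} → NestedPairs p (suc o) k → NestedPairs p o (suc k)
  widen-nested ν = record
    { outer = widen outer ; inner = widen inner
    ; outer<inner = outer<inner ; inner<outer = inner<outer }
    where open NestedPairs ν

  nestedPairs-of-count : ∀ k o → 2 + k ≤ count p o (2 * k) → NestedPairs p o k
  nestedPairs-of-count zero    o ()
  nestedPairs-of-count (suc k) o h rewrite count-peel p o k with p o in p-o | p (suc o + 2 * k) in p-end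
  ... | true  | true  = record
    { outer = outermost p-o p-end ; inner = widen π
    ; outer<inner = SymmetricPair.o≤lo π ; inner<outer = SymmetricPair.hi<end π }
    where π = symmetricPair-of-count k (suc o) (unmarked-end (≤-pred h))
  ... | true  | false = widen-nested (nestedPairs-of-count k (suc o) (unmarked-start h))
  ... | false | true  = widen-nested (nestedPairs-of-count k (suc o) (unmarked-end h))
  ... | false | false = widen-nested (nestedPairs-of-count k (suc o) (unmarked-ends h))

-- The upper bound

nestedPairs-of-large : ∀ m (S : Subset (suc (2 * m))) → m + 3 ≤ ∣ S ∣ → NestedPairs (member S) 1 m
nestedPairs-of-large m S large =
  nestedPairs-of-count m 1 (drop-zero (member S 0) (subst (m + 3 ≤_) |S| large))
  where
  |S| : ∣ S ∣ ≡ count (member S) 0 (suc (2 * m))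
  |S| = card≡count S (member S) (member-toℕ S)
  drop-zero : ∀ b {c} → m + 3 ≤ (if b then 1 else 0) + c → 2 + m ≤ c
  drop-zero true  {c} h = ≤-pred (subst (_≤ suc c) (+-comm m 3) h)
  drop-zero false {c} h = ≤-trans (n≤1+n _) (subst (_≤ c) (+-comm m 3) h)

zero-sum-of-nested : ∀ m (S : Subset (suc (2 * m))) → NestedPairs (member S) 1 m →
  HasZeroSumSubset (suc (2 * m)) 4 S
zero-sum-of-nested m S ν =
  fromList n xs , fromList-⊆ xs S marked , card-fromList xs uniq xs<n , divides 2 sum≡2n
  where
  n = suc (2 * m)
  open NestedPairs ν
  open SymmetricPair outer using ()
    renaming (lo to x₁; hi to y₁; hi<end to y₁<n; lo+hi to x₁+y₁; p-lo to x₁∈S; p-hi to y₁∈S)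
  open SymmetricPair inner using ()
    renaming (lo to x₂; hi to y₂; lo<hi to x₂<y₂; lo+hi to x₂+y₂; p-lo to x₂∈S; p-hi to y₂∈S)
  xs = x₁ ∷ x₂ ∷ y₂ ∷ y₁ ∷ []
  marked : All (λ x → member S x ≡ true) xs
  marked = x₁∈S ∷ x₂∈S ∷ y₂∈S ∷ y₁∈S ∷ []
  uniq : Unique xs
  uniq = AllPairs.map <⇒≢ (Linked⇒AllPairs <-trans (outer<inner ∷ x₂<y₂ ∷ inner<outer ∷ [-]))
  xs<n : All (_< n) xs
  xs<n = x₁<n ∷ x₂<n ∷ y₂<n ∷ y₁<n ∷ []
    where
    y₂<n = <-trans inner<outer y₁<n
    x₂<n = <-trans x₂<y₂ y₂<n
    x₁<n = <-trans outer<inner x₂<n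
  sum≡2n : subsetSum (fromList n xs) ≡ 2 * n
  sum≡2n = begin
    subsetSum (fromList n xs)     ≡⟨ subsetSum-fromList xs uniq xs<n ⟩
    x₁ + (x₂ + (y₂ + (y₁ + 0)))   ≡⟨ regroup x₁ x₂ y₂ y₁ ⟩
    (x₁ + y₁) + ((x₂ + y₂) + 0)   ≡⟨ cong₂ (λ a b → a + (b + 0)) (suc-injective x₁+y₁)
                                                               (suc-injective x₂+y₂) ⟩
    2 * n                         ∎
    where
    open ≡-Reasoning
    regroup : ∀ a b c d → a + (b + (c + (d + 0))) ≡ (a + d) + ((b + c) + 0)
    regroup = solve-∀

harborth-upper : ∀ m → HarborthProperty (2 * m + 1) 4 (m + 3)
harborth-upper m = subst (λ n → HarborthProperty n 4 (m + 3)) (+-comm 1 (2 * m))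
  (λ S large → zero-sum-of-nested m S (nestedPairs-of-large m S large))

-- The lower bound

no-multiple-between : ∀ {n x} j → j * n < x → x < suc j * n → ¬ n ∣ x
no-multiple-between {n} j above below (divides q refl) =
  <⇒≱ (*-cancelʳ-< n j q above) (≤-pred (*-cancelʳ-< n q (suc j) below))

-- t sums the elements below s of a 4-subset of {0, …, s − 1, top}: all four when the top is
-- absent, three when it is present (the top then being n in C_(suc n)).
∤-sum-without-top : ∀ {n s t} → 4 * s ≤ n + 9 → triangular 4 ≤ t → t + triangular 4 + 4 ≤ 4 * s →
  ¬ n ∣ t
∤-sum-without-top {n} {s} {t} small lower upper = no-multiple-between 0 (≤-trans (s≤s z≤n) lower) t<n
  where
  open ≤-Reasoning
  t<n : t < 1 * n
  t<n = begin-strict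
    t       <⟨ +-cancelʳ-≤ 9 (suc t) n (begin
                 suc t + 9       ≡⟨ +-suc t 9 ⟨
                 t + 10          ≡⟨ +-assoc t 6 4 ⟨
                 t + 6 + 4       ≤⟨ upper ⟩
                 4 * s           ≤⟨ small ⟩
                 n + 9           ∎) ⟩
    n       ≡⟨ *-identityˡ n ⟨
    1 * n   ∎

∤-sum-with-top : ∀ {n s t} → 3 * s < suc n + 7 → triangular 3 ≤ t → t + triangular 3 + 3 ≤ 3 * s →
  ¬ suc n ∣ t + n
∤-sum-with-top {n} {s} {t} small lower upper = no-multiple-between 1 above below
  where
  open ≤-Reasoning
  t≤1+n : t ≤ suc n
  t≤1+n = +-cancelʳ-≤ 6 t (suc n) (≤-pred (begin
    suc (t + 6)          ≡⟨ cong suc (+-assoc t 3 3) ⟨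
    suc (t + 3 + 3)      ≤⟨ s≤s upper ⟩
    suc (3 * s)          ≤⟨ small ⟩
    suc n + 7            ≡⟨ +-suc (suc n) 6 ⟩
    suc (suc n + 6)      ∎))
  above : 1 * suc n < t + n
  above = begin-strict
    1 * suc n     ≡⟨ *-identityˡ (suc n) ⟩
    suc n         <⟨ n<1+n (suc n) ⟩
    2 + n         ≤⟨ +-monoˡ-≤ n (≤-trans (n≤1+n 2) lower) ⟩
    t + n         ∎
  below : t + n < 2 * suc n
  below = begin-strict
    t + n           ≤⟨ +-monoˡ-≤ n t≤1+n ⟩
    suc n + n       <⟨ +-monoʳ-< (suc n) (n<1+n n) ⟩
    suc n + suc n   ≡⟨ cong (suc n +_) (+-identityʳ (suc n)) ⟨
    2 * suc n       ∎

segmentWithTop : ∀ n → ℕ → Subset (suc n)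
segmentWithTop n s = fromList (suc n) (n ∷ upTo s)

module _ {n s : ℕ} (s≤n : s ≤ n) where

  private
    xs : List ℕ
    xs = n ∷ upTo s

    uniq : Unique xs
    uniq = All.map (λ x<s → ≢-sym (<⇒≢ (<-≤-trans x<s s≤n))) (all-upTo s) ∷ upTo⁺ s

    xs<1+n : All (_< suc n) xs
    xs<1+n = ≤-refl ∷ All.map (λ x<s → m<n⇒m<1+n (<-≤-trans x<s s≤n)) (all-upTo s)

  card-segmentWithTop : ∣ segmentWithTop n s ∣ ≡ suc s
  card-segmentWithTop = trans (card-fromList xs uniq xs<1+n) (cong suc (length-upTo s))

  segmentWithTop-zero-sum-free : 4 * s ≤ suc n + 9 → 3 * s < suc n + 7 →
    ¬ HasZeroSumSubset (suc n) 4 (segmentWithTop n s)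
  segmentWithTop-zero-sum-free small₄ small₃ (T , T⊆B , |T|≡4 , divisible) = by-top
    where
    c = count (member T) 0 n
    t = total (member T) 0 n
    card : 4 ≡ c + (if member T n then 1 else 0)
    card = trans (sym |T|≡4)
      (trans (card≡count T (member T) (member-toℕ T)) (sumWhere-snoc _ (member T) 0 n))
    sumT : subsetSum T ≡ t + (if member T n then n else 0)
    sumT = trans (subsetSum≡total T (member T) (member-toℕ T)) (sumWhere-snoc _ (member T) 0 n)
    below-s : MarkedBelow (member T) s n
    below-s x x<n x∈T with ⊆-fromList xs T T⊆B x x∈T
    ... | here refl = contradiction x<n (n≮n x)
    ... | there x∈upTo = ∈-upTo⁻ x∈upTo
    bounds : ∀ {k} → c ≡ k → triangular k ≤ t × t + triangular k + k ≤ k * s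
    bounds refl = subst (λ z → z + triangular c ≤ t) (*-zeroʳ c) (total-≥ (member T) 0 n)
                , total-≤ (member T) s 0 n below-s
    by-top : ⊥
    by-top with member T n | card | sumT
    ... | false | 4≡c+0 | sum≡t+0 =
      let lower , upper = bounds (sym (trans 4≡c+0 (+-identityʳ c)))
      in  ∤-sum-without-top {s = s} small₄ lower upper
            (subst (suc n ∣_) (trans sum≡t+0 (+-identityʳ t)) divisible)
    ... | true  | 4≡c+1 | sum≡t+n =
      let lower , upper = bounds (suc-injective (sym (trans 4≡c+1 (+-comm c 1))))
      in  ∤-sum-with-top {s = s} small₃ lower upper (subst (suc n ∣_) sum≡t+n divisible)

harborth-lower : ∀ {n s} → s < n → 4 * s ≤ n + 9 → 3 * s < n + 7 → ¬ HarborthProperty n 4 (suc s)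
harborth-lower {suc n} s<1+n small₄ small₃ property =
  segmentWithTop-zero-sum-free s≤n small₄ small₃
    (property _ (≤-reflexive (sym (card-segmentWithTop s≤n))))
  where s≤n = ≤-pred s<1+n

HarborthProperty-mono : ∀ {n k t t′} → t ≤ t′ → HarborthProperty n k t → HarborthProperty n k t′
HarborthProperty-mono t≤t′ property S t′≤|S| = property S (≤-trans t≤t′ t′≤|S|)

allSubsets? : ∀ {n ℓ} {Q : Pred (Subset n) ℓ} → U.Decidable Q → Dec (∀ S → Q S)
allSubsets? Q? with anySubset? (¬? ∘ Q?)
... | yes (S , ¬QS) = no (λ all → ¬QS (all S))
... | no  none      = yes (λ S → decidable-stable (Q? S) (λ ¬QS → none (S , ¬QS)))

hasZeroSumSubset? : ∀ n k S → Dec (HasZeroSumSubset n k S)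
hasZeroSumSubset? n k S = anySubset? (λ T → T ⊆? S ×-dec ∣ T ∣ ≟ k ×-dec n ∣? subsetSum T)

harborthProperty? : ∀ n k t → Dec (HarborthProperty n k t)
harborthProperty? n k t = allSubsets? (λ S → t ≤? ∣ S ∣ →-dec hasZeroSumSubset? n k S)

least-witness : ∀ {ℓ} {P : Pred ℕ ℓ} → U.Decidable P → ∀ {N} → P N →
  Σ ℕ λ g → P g × (∀ t → P t → g ≤ t)
least-witness {P = P} P? {N} = <-rec (λ N → P N → Least) search N
  where
  Least = Σ ℕ λ g → P g × (∀ t → P t → g ≤ t)
  search : ∀ N → (∀ {t} → t < N → P t → Least) → P N → Least
  search N smaller pN with anyUpTo? P? N
  ... | yes (t , t<N , pt) = smaller t<N pt
  ... | no  none           = N , pN , λ t pt → ≮⇒≥ (λ t<N → none (t , t<N , pt))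

harborth-constant : ∀ {n k N} → 1 ≤ N → HarborthProperty n k N →
  Σ ℕ λ g → IsHarborthConstant n k g × g ≤ N
harborth-constant {n} {k} {N} 1≤N property
  with least-witness (λ t → 1 ≤? t ×-dec harborthProperty? n k t) (1≤N , property)
... | g , (1≤g , property-g) , least =
  g , (1≤g , property-g , λ t 1≤t property-t → least t (1≤t , property-t)) , least N (1≤N , property)

[q*d+r]/d≡q : ∀ q {r d} .{{_ : NonZero d}} → r < d → (q * d + r) / d ≡ q
[q*d+r]/d≡q q {r} {d} r<d = begin
  (q * d + r) / d      ≡⟨ +-distrib-/-∣ˡ r (divides q refl) ⟩
  q * d / d + r / d    ≡⟨ cong₂ _+_ (m*n/n≡m q d) (m<n⇒m/n≡0 r<d) ⟩
  q + 0                ≡⟨ +-identityʳ q ⟩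
  q                    ∎
  where open ≡-Reasoning

≤-by-difference : ∀ {a b} k → b ≡ a + k → a ≤ b
≤-by-difference {a} k b≡a+k = subst (a ≤_) (sym b≡a+k) (m≤m+n a k)

even-or-odd : ∀ m → Σ ℕ λ t → m ≡ t + t ⊎ m ≡ suc (t + t)
even-or-odd zero = 0 , inj₁ refl
even-or-odd (suc m) with even-or-odd m
... | t , inj₁ m≡2t   = t , inj₂ (cong suc m≡2t)
... | t , inj₂ m≡2t+1 = suc t , inj₁ (cong suc (trans m≡2t+1 (sym (+-suc t t))))

half-upper : ∀ m → (2 * m + 1 + 6) / 2 ≡ m + 3
half-upper m = trans (cong (_/ 2) (regroup m)) ([q*d+r]/d≡q (m + 3) (s≤s (s≤s z≤n)))
  where
  regroup : ∀ m → 2 * m + 1 + 6 ≡ (m + 3) * 2 + 1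
  regroup = solve-∀

lower-parameters : ∀ m → 5 ≤ 2 * m + 1 → Σ ℕ λ s →
  (2 * m + 1 + 18) / 4 ≡ s + 2 × s < 2 * m + 1 × 4 * s ≤ 2 * m + 1 + 9 × 3 * s < 2 * m + 1 + 7
lower-parameters m 5≤n with even-or-odd m
... | zero    , inj₁ refl = contradiction 5≤n λ { (s≤s ()) }
... | zero    , inj₂ refl = contradiction 5≤n λ { (s≤s (s≤s (s≤s ()))) }
... | suc u   , inj₁ refl = u + 3
  , trans (cong (_/ 4) (e₁ u)) (trans ([q*d+r]/d≡q (u + 5) (s≤s (s≤s (s≤s (s≤s z≤n))))) (e₂ u))
  , ≤-by-difference (3 * u + 1) (e₃ u) , ≤-by-difference 2 (e₄ u) , ≤-by-difference (u + 2) (e₅ u)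
  where
  e₁ : ∀ u → 2 * (suc u + suc u) + 1 + 18 ≡ (u + 5) * 4 + 3
  e₁ = solve-∀
  e₂ : ∀ u → u + 5 ≡ u + 3 + 2
  e₂ = solve-∀
  e₃ : ∀ u → 2 * (suc u + suc u) + 1 ≡ suc (u + 3) + (3 * u + 1)
  e₃ = solve-∀
  e₄ : ∀ u → 2 * (suc u + suc u) + 1 + 9 ≡ 4 * (u + 3) + 2
  e₄ = solve-∀
  e₅ : ∀ u → 2 * (suc u + suc u) + 1 + 7 ≡ suc (3 * (u + 3)) + (u + 2)
  e₅ = solve-∀
... | suc u   , inj₂ refl = u + 4
  , trans (cong (_/ 4) (e₁ u)) (trans ([q*d+r]/d≡q (u + 6) (s≤s (s≤s z≤n))) (e₂ u))
  , ≤-by-difference (3 * u + 2) (e₃ u) , ≤-by-difference 0 (e₄ u) , ≤-by-difference (u + 1) (e₅ u)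
  where
  e₁ : ∀ u → 2 * suc (suc u + suc u) + 1 + 18 ≡ (u + 6) * 4 + 1
  e₁ = solve-∀
  e₂ : ∀ u → u + 6 ≡ u + 4 + 2
  e₂ = solve-∀
  e₃ : ∀ u → 2 * suc (suc u + suc u) + 1 ≡ suc (u + 4) + (3 * u + 2)
  e₃ = solve-∀
  e₄ : ∀ u → 2 * suc (suc u + suc u) + 1 + 9 ≡ 4 * (u + 4) + 0
  e₄ = solve-∀
  e₅ : ∀ u → 2 * suc (suc u + suc u) + 1 + 7 ≡ suc (3 * (u + 4)) + (u + 1)
  e₅ = solve-∀

proposition3p17 : (n : ℕ) → 5 ≤ n → (Σ ℕ λ m → n ≡ 2 * m + 1) →
    Σ ℕ λ g → IsHarborthConstant n 4 g × (n + 18) / 4 ≤ g × g ≤ (n + 6) / 2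
proposition3p17 n 5≤n (m , refl)
  with lower-parameters m 5≤n | harborth-constant (≤-trans (s≤s z≤n) (m≤n+m 3 m)) (harborth-upper m)
... | s , L≡s+2 , s<n , small₄ , small₃ | g , constant@(_ , property , _) , g≤m+3 =
  g , constant , subst (_≤ g) (sym L≡s+2) s+2≤g , subst (g ≤_) (sym (half-upper m)) g≤m+3
  where
  s+2≤g : s + 2 ≤ g
  s+2≤g = subst (_≤ g) (+-comm 2 s) (≮⇒≥ λ g<2+s →
    harborth-lower s<n small₄ small₃ (HarborthProperty-mono (≤-pred g<2+s) property))
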